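{- Let $P\in\mathrm{APS}_d(m,n)$. Then the canonical witness $\omega_P\in\mathbb{Z}_m\wr S_n$ satisfies $\operatorname{Pin}(\omega_P)=P$.
   Context: Let $m,n$ be positive integers, $[n]=\{1,\dots,n\}$, $\xi=e^{2\pi i/m}$. For $0\le a\le m-1$, $x\in[n]$, $\xi^a(x)$ denotes $\xi^a\cdot x$; $\mathbb{I}_n^m=\bigcup_{a=0}^{m-1}\{\xi^a(1),\dots,\xi^a(n)\}$, totally ordered by $\xi^a(x)\prec\xi^b(y)$ iff $a>b$, or $a=b$ and $x>y$ (on $[n]$ this means $x\prec y$ iff $x>y$). $\mathbb{Z}_m\wr S_n$ is the group of bijections $w$ of $\mathbb{I}_n^m$ with $w(\xi^i x)=\xi^i w(x)$ for $x\in[n]$ and all $i$, written in one-line notation $w(n)w(n-1)\cdots w(1)$. $\operatorname{Pin}(w)=\{w(i):2\le i\le n-1,\ w(i+1)\prec w(i)\succ w(i-1)\}$. $P$ is admissible if $P=\operatorname{Pin}(w)$ for some $w$; $\mathrm{APS}_d(m,n)$ is the collection of admissible sets with at most $d$ elements. For admissible $P=\{\xi^{a_1}(p_1)\prec\dots\prec\xi^{a_d}(p_d)\}$ (with $d=\#P$) let $[n]\setminus\{p_1,\dots,p_d\}=\{v_1\prec\dots\prec v_{n-d}\}$. The canonical witness $\omega_P$ is defined by $\omega_P(n-2i+2)=\xi^{m-1}(v_i)$ and $\omega_P(n-2i+1)=\xi^{a_i}(p_i)$ for $1\le i\le d$, and $\omega_P(j)=\xi^{m-1}(v_{n-d-j+1})$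 for $1\le j\le n-2d$; i.e. in one-line notation $\omega_P=\xi^{m-1}(v_1)\,\xi^{a_1}(p_1)\,\xi^{m-1}(v_2)\cdots\xi^{m-1}(v_d)\,\xi^{a_d}(p_d)\,\xi^{m-1}(v_{d+1})\cdots\xi^{m-1}(v_{n-d})$. -}

module Defs where

open import Data.Nat using (ℕ; zero; suc; _∸_; NonZero; _<_)
open import Data.Nat.Properties using (n<1+n)
open import Data.Fin using (Fin; toℕ; fromℕ<) renaming (_<_ to _<ᶠ_; zero to fzero)
open import Data.Fin.Properties using (_≟_)
open import Data.List using (List; []; _∷_; map; filter; reverse; allFin)
open import Data.List.Membership.Propositional using (_∈_)
import Data.List.Membership.DecPropositional as DecMem
open import Data.Product using (_×_; _,_; proj₂; ∃)
open import Data.Sum using (_⊎_)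
open import Relation.Binary.PropositionalEquality using (_≡_)
open import Function.Definitions using (Injective)

-- A coloured letter ξ^a(x+1) of 𝕀_n^m is encoded as the pair (a , x),
-- with a : Fin m the colour and x : Fin n the (0-based) underlying letter.
CL : ℕ → ℕ → Set
CL m n = Fin m × Fin n

_≺_ : ∀ {m n} → CL m n → CL m n → Set
(a , x) ≺ (b , y) = (b <ᶠ a) ⊎ ((a ≡ b) × (y <ᶠ x))

-- An element w of ℤ_m ≀ S_n is determined by its values on [n]
-- (w(ξ^i x) = ξ^i w(x)); it is a bijection of 𝕀_n^m iff the underlying
-- letters of w(1),…,w(n) form a permutation of [n].
-- We encode a map on [n] as f : Fin n → CL m n with f j = w(j+1).
IsColPerm : ∀ {m n} → (Fin n → CL m n) → Set
IsColPerm f = Injective _≡_ _≡_ (λ j → proj₂ (f j))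

ColPerm : ℕ → ℕ → Set
ColPerm m n = ∃ λ (f : Fin n → CL m n) → IsColPerm f

-- c ∈ Pin(w): c = w(i) for some 2 ≤ i ≤ n-1 with w(i+1) ≺ w(i) ≻ w(i-1).
-- Here j, l, k are the 0-based positions of i, i-1, i+1.
InPin : ∀ {m n} → (Fin n → CL m n) → CL m n → Set
InPin {m} {n} f c =
  ∃ λ (j : Fin n) → ∃ λ (l : Fin n) → ∃ λ (k : Fin n) →
    (toℕ j ≡ suc (toℕ l)) × (toℕ k ≡ suc (toℕ j)) ×
    (f l ≺ f j) × (f k ≺ f j) × (f j ≡ c)

-- A finite set P ⊆ 𝕀_n^m is represented by the list of its elements in
-- strictly ≺-increasing order (AllPairs _≺_ P); its set of elements is _∈ P.
-- P is admissible if P = Pin(w) for some w ∈ ℤ_m ≀ S_n.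
Admissible : ∀ {m n} → List (CL m n) → Set
Admissible {m} {n} P =
  ∃ λ (w : ColPerm m n) → ∀ c → (c ∈ P → InPin (Data.Product.proj₁ w) c)
                                × (InPin (Data.Product.proj₁ w) c → c ∈ P)

topColour : (m : ℕ) → .{{NonZero m}} → Fin m
topColour (suc m) = fromℕ< {m} (n<1+n m)

-- the letters of [n] not among the underlying letters of P,
-- listed in ≺-increasing order v₁ ≺ v₂ ≺ … (i.e. decreasing as numbers)
complementLetters : ∀ {m} n → List (CL m n) → List (Fin n)
complementLetters n P = filter (λ x → DecMem._∉?_ (_≟_ {n}) x (map proj₂ P)) (reverse (allFin n))

interleave : ∀ {A : Set} → List A → List A → List A
interleave (v ∷ vs) (q ∷ qs) = v ∷ q ∷ interleave vs qs
interleave vs [] = vs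
interleave [] qs = qs

nthOr : ∀ {A : Set} → A → List A → ℕ → A
nthOr d [] _ = d
nthOr d (x ∷ xs) zero = x
nthOr d (x ∷ xs) (suc i) = nthOr d xs i

-- One-line word ω(n) ω(n-1) … ω(1) of the canonical witness:
-- ξ^{m-1}(v₁) ξ^{a₁}(p₁) ξ^{m-1}(v₂) … ξ^{m-1}(v_d) ξ^{a_d}(p_d) ξ^{m-1}(v_{d+1}) … ξ^{m-1}(v_{n-d})
canonicalWord : (m n : ℕ) → .{{NonZero m}} → List (CL m n) → List (CL m n)
canonicalWord m n P =
  interleave (map (λ v → (topColour m , v)) (complementLetters n P)) P

-- The canonical witness ω_P as a map on [n]: ω_P(j+1) is the
-- (n-1-j)-th (0-based) entry of the one-line word.
-- (The default value is never used when the word has length n.)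
canonicalWitness : (m n : ℕ) → .{{NonZero m}} → .{{NonZero n}} →
                   List (CL m n) → Fin n → CL m n
canonicalWitness m n P j =
  nthOr (topColour m , j) (canonicalWord m n P) (n ∸ 1 ∸ toℕ j)

{-# OPTIONS --safe #-}
-- The canonical word is v₁ p₁ v₂ p₂ … with the top-coloured vᵢ increasing, so its peak set
-- is exactly P once vᵢ ≺ pᵢ ≻ vᵢ₊₁ for all i; for the i-th smallest c ∈ P this asks for at
-- least i + 1 of the vᵢ strictly below c.  A witness w with Pin(w) = P supplies them: among
-- the entries of w that are ⪯ c, the non-peaks outnumber the peaks (match every peak with its
-- smaller right neighbour; the left neighbour of the first such peak is left over), and
-- recolouring these non-peaks with the top colour gives distinct vⱼ strictly below c.
-- Finally ω_P lists the canonical word backwards, and peak sets are invariant under reversal.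
module Submission where

open import Data.Fin using (Fin; toℕ; fromℕ; inject₁)
  renaming (zero to fzero; suc to fsuc; _<_ to _<ᶠ_; _≤_ to _≤ᶠ_)
import Data.Fin.Properties as Fin
open import Data.Fin.Properties using (toℕ-fromℕ; toℕ-inject₁; toℕ≤pred[n])
open import Data.List using (List; []; _∷_; _++_; _∷ʳ_; length; map; filter; reverse; tabulate; allFin)
open import Data.List.Membership.Propositional using (_∈_; _∉_)
open import Data.List.Membership.Propositional.Properties
  using (∈-filter⁺; ∈-filter⁻; ∈-tabulate⁺; ∈-allFin; ∈-map⁺; ∈-map⁻)
open import Data.List.Properties
  using ( map-++; map-∘; map-id; map-tabulate; reverse-map; length-map; length-tabulate
        ; filter-accept; filter-reject; filter-none; filter-notAll; length-filter
        ; unfold-reverse; reverse-++; reverse-involutive; tabulate-cong; ++-identityʳ)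
open import Data.List.Relation.Binary.Permutation.Propositional
  using (_↭_; ↭-refl; ↭-sym; ↭-trans; ↭-reflexive; prep; ↭⇒↭ₛ; module PermutationReasoning)
open import Data.List.Relation.Binary.Permutation.Propositional.Properties
  using (shift; ↭-reverse; All-resp-↭; ∈-resp-↭) renaming (map⁺ to ↭-map⁺)
import Data.List.Relation.Binary.Permutation.Setoid.Properties as ↭ₛ
open import Data.List.Relation.Binary.Subset.Propositional using (_⊆_)
open import Data.List.Relation.Binary.Subset.Propositional.Properties using (∷⁺ʳ)
open import Data.List.Relation.Unary.All as All using (All; []; _∷_)
import Data.List.Relation.Unary.All.Properties as All
open import Data.List.Relation.Unary.AllPairs as AllPairs using (AllPairs; []; _∷_)
import Data.List.Relation.Unary.AllPairs.Properties as AllPairs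
open import Data.List.Relation.Unary.Any as Any using (Any; here; there)
import Data.List.Relation.Unary.Any.Properties as Any
open import Data.List.Relation.Unary.Unique.Propositional using (Unique)
import Data.List.Relation.Unary.Unique.Propositional.Properties as Unique
open import Data.Nat using (ℕ; zero; suc; _≤_; _<_; _∸_; NonZero; z≤n; s≤s; s≤s⁻¹)
open import Data.Nat.Properties
  using ( suc-injective; ≤-refl; ≤-reflexive; ≤-antisym; ≤-trans; n≤1+n; n<1+n; +-∸-assoc; n∸n≡0
        ; module ≤-Reasoning)
open import Data.Product using (_×_; _,_; proj₁; proj₂; ∃)
open import Data.Product.Properties using (≡-dec)
open import Data.Product.Relation.Binary.Lex.Strict using (×-transitive; ×-irreflexive; ×-decidable)
open import Data.Sum using (inj₁; inj₂)
open import Function using (_∘_; _on_; flip; id; case_of_)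
open import Function.Definitions using (Injective)
open import Level using (0ℓ)
open import Relation.Binary.Core using (Rel)
import Relation.Binary.Construct.Flip.EqAndOrd as Flip
open import Relation.Binary.Definitions
  using (DecidableEquality; Symmetric; Irreflexive; Transitive; _Respects_) renaming (Decidable to Decidable₂)
open import Relation.Binary.PropositionalEquality
  using (_≡_; _≢_; refl; sym; trans; cong; cong₂; subst; setoid; isEquivalence; resp₂; module ≡-Reasoning)
open import Relation.Binary.Structures using (IsDecStrictPartialOrder)
open import Relation.Nullary using (¬_; contradiction; Dec; yes; no)
open import Relation.Nullary.Decidable using (_×-dec_)
open import Relation.Unary using (Pred; Decidable)
open import Relation.Unary.Properties using (∁?)

open import Defs

private
  ∸-toℕ : ∀ {n} (j : Fin n) → n ∸ toℕ j ≡ suc (n ∸ 1 ∸ toℕ j)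
  ∸-toℕ {suc n} j = +-∸-assoc 1 (toℕ≤pred[n] j)

module _ {A : Set} where

  Unique-resp-↭ : Unique {A = A} Respects _↭_
  Unique-resp-↭ σ = ↭ₛ.Unique-resp-↭ (setoid A) (↭⇒↭ₛ σ)

  Unique-length-≤ : DecidableEquality A → ∀ {xs ys : List A} →
                    Unique xs → xs ⊆ ys → length xs ≤ length ys
  Unique-length-≤ _≟_ {[]} _ _ = z≤n
  Unique-length-≤ _≟_ {x ∷ xs} {ys} (x∉xs ∷ xs!) xs⊆ys =
    ≤-trans (s≤s (Unique-length-≤ _≟_ xs! xs⊆ys-x)) (filter-notAll (∁? (x ≟_)) ys x∈ys)
    where
    xs⊆ys-x : xs ⊆ filter (∁? (x ≟_)) ys
    xs⊆ys-x y∈xs = ∈-filter⁺ (∁? (x ≟_)) (xs⊆ys (there y∈xs)) (All.lookup x∉xs y∈xs)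
    x∈ys : Any (λ y → ¬ ¬ x ≡ y) ys
    x∈ys = Any.map (λ x≡y x≢y → x≢y x≡y) (xs⊆ys (here refl))

  Unique-map⁺-local : ∀ {B : Set} {f : A → B} {xs} →
                      (∀ {a b} → a ∈ xs → b ∈ xs → f a ≡ f b → a ≡ b) → Unique xs → Unique (map f xs)
  Unique-map⁺-local {xs = []} _ [] = []
  Unique-map⁺-local {xs = x ∷ xs} f-inj (x∉xs ∷ xs!) =
    All.map⁺ (All.tabulate λ y∈xs → All.lookup x∉xs y∈xs ∘ f-inj (here refl) (there y∈xs))
    ∷ Unique-map⁺-local (λ a∈ b∈ → f-inj (there a∈) (there b∈)) xs!

  AllPairs-reverse⁺ : ∀ {ℓ} {R : Rel A ℓ} {xs} → AllPairs R xs → AllPairs (flip R) (reverse xs)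
  AllPairs-reverse⁺ {xs = []} [] = []
  AllPairs-reverse⁺ {R = R} {xs = x ∷ xs} (x<xs ∷ xs↑) =
    subst (AllPairs (flip R)) (sym (unfold-reverse x xs))
      (AllPairs.++⁺ (AllPairs-reverse⁺ xs↑) ([] ∷ [])
                    (All.map (_∷ []) (All-resp-↭ (↭-sym (↭-reverse xs)) x<xs)))

  interleave-↭ : (xs ys : List A) → interleave xs ys ↭ xs ++ ys
  interleave-↭ (x ∷ xs) (y ∷ ys) = prep x (↭-trans (prep y (interleave-↭ xs ys)) (↭-sym (shift y xs ys)))
  interleave-↭ (x ∷ xs) [] = ↭-reflexive (sym (++-identityʳ (x ∷ xs)))
  interleave-↭ [] [] = ↭-refl
  interleave-↭ [] (y ∷ ys) = ↭-refl

  count : ∀ {ℓ} {P : Pred A ℓ} → Decidable P → List A → ℕ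
  count P? = length ∘ filter P?

  module _ {ℓ} {P : Pred A ℓ} (P? : Decidable P) where

    count-accept : ∀ {x xs} → P x → count P? (x ∷ xs) ≡ suc (count P? xs)
    count-accept Px = cong length (filter-accept P? Px)

    count-reject : ∀ {x xs} → ¬ P x → count P? (x ∷ xs) ≡ count P? xs
    count-reject ¬Px = cong length (filter-reject P? ¬Px)

    count-∷-≤-suc : ∀ {x xs} → count P? (x ∷ xs) ≤ suc (count P? xs)
    count-∷-≤-suc {x} with P? x
    ... | yes _ = ≤-refl
    ... | no _ = n≤1+n _

    count-≤-∷ : ∀ {x xs} → count P? xs ≤ count P? (x ∷ xs)
    count-≤-∷ {x} with P? x
    ... | yes _ = n≤1+n _
    ... | no _ = ≤-refl

    count-∷-mono : ∀ {x y xs ys} → (P x → P y) →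
                   count P? xs ≤ count P? ys → count P? (x ∷ xs) ≤ count P? (y ∷ ys)
    count-∷-mono {x} {y} Px⇒Py xs≤ys with P? x | P? y
    ... | yes _  | yes _  = s≤s xs≤ys
    ... | yes Px | no ¬Py = contradiction (Px⇒Py Px) ¬Py
    ... | no _   | yes _  = ≤-trans xs≤ys (n≤1+n _)
    ... | no _   | no _   = xs≤ys

  tabulate-∷ʳ : ∀ {n} (f : Fin (suc n) → A) → tabulate f ≡ tabulate (f ∘ inject₁) ∷ʳ f (fromℕ n)
  tabulate-∷ʳ {zero} f = refl
  tabulate-∷ʳ {suc n} f = cong (f fzero ∷_) (tabulate-∷ʳ (f ∘ fsuc))

  Unique-tabulate⁻ : ∀ {n} {f : Fin n → A} → Unique (tabulate f) → Injective _≡_ _≡_ f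
  Unique-tabulate⁻ _ {fzero} {fzero} _ = refl
  Unique-tabulate⁻ (f₀∉ ∷ _) {fzero} {fsuc j} f₀≡fⱼ = contradiction f₀≡fⱼ (All.lookup f₀∉ (∈-tabulate⁺ j))
  Unique-tabulate⁻ (f₀∉ ∷ _) {fsuc i} {fzero} fᵢ≡f₀ = contradiction (sym fᵢ≡f₀) (All.lookup f₀∉ (∈-tabulate⁺ i))
  Unique-tabulate⁻ (_ ∷ f!) {fsuc i} {fsuc j} fᵢ≡fⱼ = cong fsuc (Unique-tabulate⁻ f! fᵢ≡fⱼ)

  tabulate-nthOr-reverse : ∀ {n} (d : Fin n → A) (xs : List A) → length xs ≡ n →
                           tabulate (λ j → nthOr (d j) xs (n ∸ 1 ∸ toℕ j)) ≡ reverse xs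
  tabulate-nthOr-reverse d [] refl = refl
  tabulate-nthOr-reverse d (x ∷ xs) refl = begin
    tabulate ω                             ≡⟨ tabulate-∷ʳ ω ⟩
    tabulate (ω ∘ inject₁) ∷ʳ ω (fromℕ L)  ≡⟨ cong₂ _∷ʳ_ (trans (tabulate-cong ω∘inject₁) IH) ω-last ⟩
    reverse xs ∷ʳ x                        ≡⟨ unfold-reverse x xs ⟨
    reverse (x ∷ xs)                       ∎
    where
    open ≡-Reasoning
    L = length xs
    ω : Fin (suc L) → A
    ω j = nthOr (d j) (x ∷ xs) (L ∸ toℕ j)
    IH = tabulate-nthOr-reverse (d ∘ inject₁) xs refl
    ω∘inject₁ : ∀ j → ω (inject₁ j) ≡ nthOr (d (inject₁ j)) xs (L ∸ 1 ∸ toℕ j)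
    ω∘inject₁ j = cong (nthOr _ (x ∷ xs)) (trans (cong (L ∸_) (toℕ-inject₁ j)) (∸-toℕ j))
    ω-last : ω (fromℕ L) ≡ x
    ω-last = cong (nthOr _ (x ∷ xs)) (trans (cong (L ∸_) (toℕ-fromℕ L)) (n∸n≡0 L))

length-Unique-covering : ∀ {n} {xs : List (Fin n)} → Unique xs → (∀ x → x ∈ xs) → length xs ≡ n
length-Unique-covering {n} {xs} xs! complete = ≤-antisym
  (≤-trans (Unique-length-≤ Fin._≟_ xs! (λ {x} _ → ∈-allFin x)) (≤-reflexive (length-tabulate id)))
  (≤-trans (≤-reflexive (sym (length-tabulate id)))
           (Unique-length-≤ Fin._≟_ (Unique.allFin⁺ n) (λ {x} _ → complete x)))

-- Peaks of a word over a strict order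

module Peaks {A : Set} {_⊏_ : Rel A 0ℓ} (⊏-isDecStrictPartialOrder : IsDecStrictPartialOrder _≡_ _⊏_) where

  open IsDecStrictPartialOrder ⊏-isDecStrictPartialOrder
    using (_≟_) renaming (_<?_ to _⊏?_; trans to ⊏-trans; asym to ⊏-asym)
  open ≤-Reasoning
  open import Relation.Binary.Construct.StrictToNonStrict _≡_ _⊏_ public
    using () renaming (_≤_ to _⊑_; decidable to ⊑-decidable)

  _⊑?_ : Decidable₂ _⊑_
  _⊑?_ = ⊑-decidable _≟_ _⊏?_

  private
    variable
      x y z c : A
      xs ys zs : List A

  data Peak : List A → A → Set where
    here  : x ⊏ y → z ⊏ y → Peak (x ∷ y ∷ z ∷ zs) y
    there : Peak xs c → Peak (x ∷ xs) c

  Peak-++⁺ˡ : Peak xs c → Peak (xs ++ ys) c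
  Peak-++⁺ˡ (here x⊏y z⊏y) = here x⊏y z⊏y
  Peak-++⁺ˡ (there p) = there (Peak-++⁺ˡ p)

  Peak-++⁺ʳ : ∀ xs → Peak ys c → Peak (xs ++ ys) c
  Peak-++⁺ʳ [] p = p
  Peak-++⁺ʳ (x ∷ xs) p = there (Peak-++⁺ʳ xs p)

  Peak-reverse⁺ : Peak xs c → Peak (reverse xs) c
  Peak-reverse⁺ (here {x} {y} {z} {zs} x⊏y z⊏y) =
    subst (λ ws → Peak ws y) (sym (reverse-++ (x ∷ y ∷ z ∷ []) zs))
      (Peak-++⁺ʳ (reverse zs) (here z⊏y x⊏y))
  Peak-reverse⁺ (there {xs} {c} {x} p) =
    subst (λ ws → Peak ws c) (sym (unfold-reverse x xs)) (Peak-++⁺ˡ (Peak-reverse⁺ p))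

  Peak-reverse⁻ : Peak (reverse xs) c → Peak xs c
  Peak-reverse⁻ {xs} {c} p = subst (λ ws → Peak ws c) (reverse-involutive xs) (Peak-reverse⁺ p)

  Peak-tabulate⁺ : ∀ {n} (f : Fin n → A) {l j r : Fin n} →
                   toℕ j ≡ suc (toℕ l) → toℕ r ≡ suc (toℕ j) → f l ⊏ f j → f r ⊏ f j → Peak (tabulate f) (f j)
  Peak-tabulate⁺ f {fzero} {fsuc fzero} {fsuc (fsuc fzero)} _ _ fl⊏fj fr⊏fj = here fl⊏fj fr⊏fj
  Peak-tabulate⁺ f {fsuc l} {fsuc j} {fsuc r} j≡1+l r≡1+j fl⊏fj fr⊏fj =
    there (Peak-tabulate⁺ (f ∘ fsuc) (suc-injective j≡1+l) (suc-injective r≡1+j) fl⊏fj fr⊏fj)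
  Peak-tabulate⁺ f {fzero} {fzero} ()
  Peak-tabulate⁺ f {fzero} {fsuc (fsuc _)} ()
  Peak-tabulate⁺ f {fzero} {fsuc fzero} {fzero} _ ()
  Peak-tabulate⁺ f {fzero} {fsuc fzero} {fsuc fzero} _ ()
  Peak-tabulate⁺ f {fzero} {fsuc fzero} {fsuc (fsuc (fsuc _))} _ ()
  Peak-tabulate⁺ f {fsuc _} {fzero} ()
  Peak-tabulate⁺ f {fsuc _} {fsuc _} {fzero} _ ()

  Peak-tabulate⁻ : ∀ {n} (f : Fin n → A) → Peak (tabulate f) c →
                   ∃ λ j → ∃ λ l → ∃ λ r →
                     toℕ j ≡ suc (toℕ l) × toℕ r ≡ suc (toℕ j) × f l ⊏ f j × f r ⊏ f j × f j ≡ c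
  Peak-tabulate⁻ {n = suc (suc (suc _))} f (here fl⊏fj fr⊏fj) =
    fsuc fzero , fzero , fsuc (fsuc fzero) , refl , refl , fl⊏fj , fr⊏fj , refl
  Peak-tabulate⁻ {n = suc _} f (there p) with Peak-tabulate⁻ (f ∘ fsuc) p
  ... | j , l , r , j≡1+l , r≡1+j , fl⊏fj , fr⊏fj , fj≡c =
    fsuc j , fsuc l , fsuc r , cong suc j≡1+l , cong suc r≡1+j , fl⊏fj , fr⊏fj , fj≡c

  isPeak? : ∀ x y z → Dec (x ⊏ y × z ⊏ y)
  isPeak? x y z = (x ⊏? y) ×-dec (z ⊏? y)

  -- Unlike `if does d`, this does not unfold d, so proofs can still abstract over isPeak? x y z.
  private
    ifDec_then_else_ : ∀ {P B : Set} → Dec P → B → B → B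
    ifDec yes _ then b else _ = b
    ifDec no _ then _ else b = b

  -- After a peak y the next entry z ⊏ y cannot be a peak, so the scan restarts at z.
  peaks nonPeaks : List A → List A
  peaks (x ∷ y ∷ z ∷ zs) = ifDec isPeak? x y z then y ∷ peaks (z ∷ zs) else peaks (y ∷ z ∷ zs)
  peaks _ = []
  nonPeaks (x ∷ y ∷ z ∷ zs) =
    x ∷ (ifDec isPeak? x y z then nonPeaks (z ∷ zs) else nonPeaks (y ∷ z ∷ zs))
  nonPeaks xs = xs

  Peak⇒∈peaks : Peak xs c → c ∈ peaks xs
  Peak⇒∈peaks (here {x} {y} {z} x⊏y z⊏y) with isPeak? x y z
  ... | yes _ = here refl
  ... | no ¬peak = contradiction (x⊏y , z⊏y) ¬peak
  Peak⇒∈peaks (there {y ∷ z ∷ zs} {x = x} p) with isPeak? x y z | p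
  ... | yes (_ , z⊏y) | here y⊏z _ = contradiction z⊏y (⊏-asym y⊏z)
  ... | yes _         | there p′ = there (Peak⇒∈peaks p′)
  ... | no _          | _ = Peak⇒∈peaks p
  Peak⇒∈peaks (there {_ ∷ []} (there ()))

  peaks-⊆ : ∀ xs → peaks xs ⊆ xs
  peaks-⊆ (x ∷ y ∷ z ∷ zs) with isPeak? x y z | peaks-⊆ (z ∷ zs) | peaks-⊆ (y ∷ z ∷ zs)
  ... | yes _ | ih | _ = λ { (here c≡y) → there (here c≡y) ; (there c∈) → there (there (ih c∈)) }
  ... | no _  | _ | ih = there ∘ ih
  peaks-⊆ [] ()
  peaks-⊆ (_ ∷ []) ()
  peaks-⊆ (_ ∷ _ ∷ []) ()

  nonPeaks-⊆ : ∀ xs → nonPeaks xs ⊆ xs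
  nonPeaks-⊆ (x ∷ y ∷ z ∷ zs) with isPeak? x y z | nonPeaks-⊆ (z ∷ zs) | nonPeaks-⊆ (y ∷ z ∷ zs)
  ... | yes _ | ih | _ = ∷⁺ʳ x (there ∘ ih)
  ... | no _  | _ | ih = ∷⁺ʳ x ih
  nonPeaks-⊆ [] = id
  nonPeaks-⊆ (_ ∷ []) = id
  nonPeaks-⊆ (_ ∷ _ ∷ []) = id

  AllPairs-nonPeaks⁺ : ∀ {ℓ} {R : Rel A ℓ} xs → AllPairs R xs → AllPairs R (nonPeaks xs)
  AllPairs-nonPeaks⁺ (x ∷ y ∷ z ∷ zs) (Rx ∷ Ry ∷ R-zzs)
    with isPeak? x y z | AllPairs-nonPeaks⁺ (z ∷ zs) | AllPairs-nonPeaks⁺ (y ∷ z ∷ zs)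
  ... | yes _ | ih | _ = All.anti-mono (there ∘ nonPeaks-⊆ (z ∷ zs)) Rx ∷ ih R-zzs
  ... | no _  | _ | ih = All.anti-mono (nonPeaks-⊆ (y ∷ z ∷ zs)) Rx ∷ ih (Ry ∷ R-zzs)
  AllPairs-nonPeaks⁺ [] R-xs = R-xs
  AllPairs-nonPeaks⁺ (_ ∷ []) R-xs = R-xs
  AllPairs-nonPeaks⁺ (_ ∷ _ ∷ []) R-xs = R-xs

  AllPairs-nonPeaks-peaks : ∀ {ℓ} {R : Rel A ℓ} → Symmetric R → ∀ xs → AllPairs R xs →
                            ∀ {e c} → e ∈ nonPeaks xs → c ∈ peaks xs → R e c
  AllPairs-nonPeaks-peaks sym (x ∷ y ∷ z ∷ zs) (Rx ∷ Ry ∷ R-zzs)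
    with isPeak? x y z | AllPairs-nonPeaks-peaks sym (z ∷ zs) | AllPairs-nonPeaks-peaks sym (y ∷ z ∷ zs)
  ... | yes _ | ih | _ = λ
    { (here refl) c∈         → All.lookup Rx (∷⁺ʳ y (peaks-⊆ (z ∷ zs)) c∈)
    ; (there e∈) (here refl) → sym (All.lookup Ry (nonPeaks-⊆ (z ∷ zs) e∈))
    ; (there e∈) (there c∈)  → ih R-zzs e∈ c∈
    }
  ... | no _ | _ | ih = λ
    { (here refl) c∈ → All.lookup Rx (peaks-⊆ (y ∷ z ∷ zs) c∈)
    ; (there e∈) c∈  → ih (Ry ∷ R-zzs) e∈ c∈
    }
  AllPairs-nonPeaks-peaks _ [] _ _ ()
  AllPairs-nonPeaks-peaks _ (_ ∷ []) _ _ ()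
  AllPairs-nonPeaks-peaks _ (_ ∷ _ ∷ []) _ _ ()

  module _ {Q : Pred A 0ℓ} (Q? : Decidable Q) (Q-down : ∀ {x y} → x ⊏ y → Q y → Q x) where

    -- The first entry is matched with itself and every peak with its right neighbour, a smaller non-peak.
    count-head∷peaks≤nonPeaks : ∀ x ys → count Q? (x ∷ peaks (x ∷ ys)) ≤ count Q? (nonPeaks (x ∷ ys))
    count-head∷peaks≤nonPeaks x (y ∷ z ∷ zs)
      with isPeak? x y z | count-head∷peaks≤nonPeaks z zs | count-head∷peaks≤nonPeaks y (z ∷ zs)
    ... | yes (_ , z⊏y) | ih | _ = count-∷-mono Q? id (≤-trans (count-∷-mono Q? (Q-down z⊏y) ≤-refl) ih)
    ... | no _          | _ | ih = count-∷-mono Q? id (≤-trans (count-≤-∷ Q?) ih)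
    count-head∷peaks≤nonPeaks x [] = ≤-refl
    count-head∷peaks≤nonPeaks x (y ∷ []) = count-∷-mono Q? id z≤n

    count-peaks<nonPeaks : ∀ xs → Any Q (peaks xs) → count Q? (peaks xs) < count Q? (nonPeaks xs)
    count-peaks<nonPeaks (x ∷ y ∷ z ∷ zs)
      with isPeak? x y z | Q? y | count-peaks<nonPeaks (z ∷ zs) | count-peaks<nonPeaks (y ∷ z ∷ zs)
    ... | yes (x⊏y , z⊏y) | yes Qy | _ | _ = λ _ → begin-strict
      count Q? (y ∷ peaks (z ∷ zs))      ≡⟨ count-accept Q? Qy ⟩
      suc (count Q? (peaks (z ∷ zs)))    ≡⟨ count-accept Q? (Q-down z⊏y Qy) ⟨
      count Q? (z ∷ peaks (z ∷ zs))      ≤⟨ count-head∷peaks≤nonPeaks z zs ⟩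
      count Q? (nonPeaks (z ∷ zs))       <⟨ n<1+n _ ⟩
      suc (count Q? (nonPeaks (z ∷ zs))) ≡⟨ count-accept Q? (Q-down x⊏y Qy) ⟨
      count Q? (x ∷ nonPeaks (z ∷ zs))   ∎
    ... | yes _ | no ¬Qy | ih | _ = λ
      { (here Qy) → contradiction Qy ¬Qy
      ; (there Q-peak) → begin-strict
          count Q? (y ∷ peaks (z ∷ zs))    ≡⟨ count-reject Q? ¬Qy ⟩
          count Q? (peaks (z ∷ zs))        <⟨ ih Q-peak ⟩
          count Q? (nonPeaks (z ∷ zs))     ≤⟨ count-≤-∷ Q? ⟩
          count Q? (x ∷ nonPeaks (z ∷ zs)) ∎
      }
    ... | no _ | _ | _ | ih = λ Q-peak → ≤-trans (ih Q-peak) (count-≤-∷ Q?)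
    count-peaks<nonPeaks [] ()
    count-peaks<nonPeaks (_ ∷ []) ()
    count-peaks<nonPeaks (_ ∷ _ ∷ []) ()

  data Zigzag : List A → List A → Set where
    done : AllPairs _⊏_ xs → Zigzag xs []
    step : x ⊏ y → y ⊏ z → Zigzag (y ∷ xs) zs → Zigzag (x ∷ y ∷ xs) (z ∷ zs)

  AllPairs⇒¬Peak : AllPairs _⊏_ xs → ¬ Peak xs c
  AllPairs⇒¬Peak (_ ∷ (y⊏z ∷ _) ∷ _) (here _ z⊏y) = ⊏-asym y⊏z z⊏y
  AllPairs⇒¬Peak (_ ∷ xs↑) (there p) = AllPairs⇒¬Peak xs↑ p

  Peak-interleave⁺ : Zigzag xs ys → c ∈ ys → Peak (interleave xs ys) c
  Peak-interleave⁺ (step {zs = []} x⊏y y⊏z _) (here refl) = here (⊏-trans x⊏y y⊏z) y⊏z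
  Peak-interleave⁺ (step {zs = _ ∷ _} x⊏y y⊏z _) (here refl) = here (⊏-trans x⊏y y⊏z) y⊏z
  Peak-interleave⁺ (step _ _ zz) (there c∈) = there (there (Peak-interleave⁺ zz c∈))

  Peak-interleave⁻ : Zigzag xs ys → Peak (interleave xs ys) c → c ∈ ys
  Peak-interleave⁻ (done {[]} _) ()
  Peak-interleave⁻ (done {_ ∷ _} xs↑) p = contradiction p (AllPairs⇒¬Peak xs↑)
  Peak-interleave⁻ (step {zs = []} _ _ _) (here _ _) = here refl
  Peak-interleave⁻ (step {zs = []} _ y⊏z _) (there (here z⊏y _)) = contradiction y⊏z (⊏-asym z⊏y)
  Peak-interleave⁻ (step {zs = []} _ _ zz) (there (there p)) = there (Peak-interleave⁻ zz p)
  Peak-interleave⁻ (step {zs = _ ∷ _} _ _ _) (here _ _) = here refl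
  Peak-interleave⁻ (step {zs = _ ∷ _} _ y⊏z _) (there (here z⊏y _)) = contradiction y⊏z (⊏-asym z⊏y)
  Peak-interleave⁻ (step {zs = _ ∷ _} _ _ zz) (there (there p)) = there (Peak-interleave⁻ zz p)

  ⊏-⊑-trans : x ⊏ y → y ⊑ z → x ⊏ z
  ⊏-⊑-trans x⊏y (inj₁ y⊏z) = ⊏-trans x⊏y y⊏z
  ⊏-⊑-trans x⊏y (inj₂ refl) = x⊏y

  ⊑-⊏-trans : x ⊑ y → y ⊏ z → x ⊏ z
  ⊑-⊏-trans (inj₁ x⊏y) y⊏z = ⊏-trans x⊏y y⊏z
  ⊑-⊏-trans (inj₂ refl) y⊏z = y⊏z

  EnoughBelow : List A → List A → Set
  EnoughBelow xs ys = ∀ {c} → c ∈ ys → suc (count (_⊑? c) ys) ≤ count (_⊏? c) xs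

  private
    two-below-head : EnoughBelow xs (z ∷ ys) → 2 ≤ count (_⊏? z) xs
    two-below-head {xs} {z} {ys} enough = begin
      2                             ≤⟨ s≤s (s≤s z≤n) ⟩
      suc (suc (count (_⊑? z) ys))  ≡⟨ cong suc (count-accept (_⊑? z) (inj₂ refl)) ⟨
      suc (count (_⊑? z) (z ∷ ys))  ≤⟨ enough (here refl) ⟩
      count (_⊏? z) xs              ∎

    none-below : AllPairs _⊏_ (y ∷ xs) → ¬ y ⊏ z → All (λ w → ¬ w ⊏ z) (y ∷ xs)
    none-below (y⊏xs ∷ _) y⋢z = y⋢z ∷ All.map (λ y⊏w w⊏z → y⋢z (⊏-trans y⊏w w⊏z)) y⊏xs

    second⊏ : AllPairs _⊏_ (x ∷ y ∷ xs) → 2 ≤ count (_⊏? z) (x ∷ y ∷ xs) → y ⊏ z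
    second⊏ {x} {y} {xs} {z} (_ ∷ yxs↑) 2≤count with y ⊏? z
    ... | yes y⊏z = y⊏z
    ... | no y⋢z with s≤s () ← begin
      2                             ≤⟨ 2≤count ⟩
      count (_⊏? z) (x ∷ y ∷ xs)    ≤⟨ count-∷-≤-suc (_⊏? z) {x} ⟩
      suc (count (_⊏? z) (y ∷ xs))  ≡⟨ cong (suc ∘ length) (filter-none (_⊏? z) (none-below yxs↑ y⋢z)) ⟩
      1                             ∎

  EnoughBelow⇒Zigzag : AllPairs _⊏_ xs → AllPairs _⊏_ ys → EnoughBelow xs ys → Zigzag xs ys
  EnoughBelow⇒Zigzag {ys = []} xs↑ _ _ = done xs↑
  EnoughBelow⇒Zigzag {x ∷ y ∷ xs} {z ∷ ys} xyxs↑@(x⊏yxs ∷ yxs↑) (z⊏ys ∷ ys↑) enough =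
    step (All.head x⊏yxs) (second⊏ xyxs↑ (two-below-head {xs = x ∷ y ∷ xs} enough))
         (EnoughBelow⇒Zigzag yxs↑ ys↑ enough′)
    where
    enough′ : EnoughBelow (y ∷ xs) ys
    enough′ {c} c∈ys = s≤s⁻¹ (begin
      suc (suc (count (_⊑? c) ys))  ≡⟨ cong suc (count-accept (_⊑? c) (inj₁ (All.lookup z⊏ys c∈ys))) ⟨
      suc (count (_⊑? c) (z ∷ ys))  ≤⟨ enough (there c∈ys) ⟩
      count (_⊏? c) (x ∷ y ∷ xs)    ≤⟨ count-∷-≤-suc (_⊏? c) {x} ⟩
      suc (count (_⊏? c) (y ∷ xs))  ∎)
  EnoughBelow⇒Zigzag {[]} {_ ∷ _} _ _ enough with () ← two-below-head {xs = []} enough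
  EnoughBelow⇒Zigzag {x ∷ []} {z ∷ _} _ _ enough
    with s≤s () ← ≤-trans (two-below-head {xs = x ∷ []} enough) (length-filter (_⊏? z) (x ∷ []))

-- Coloured letters

module _ {m n : ℕ} where

  private
    _>_ : ∀ {k} → Rel (Fin k) 0ℓ
    _>_ = flip _<ᶠ_

    >-irrefl : ∀ {k} → Irreflexive _≡_ (_>_ {k})
    >-irrefl = Fin.<-irrefl ∘ sym

    >-trans : ∀ {k} → Transitive (_>_ {k})
    >-trans = Flip.trans _<ᶠ_ Fin.<-trans

  -- _≺_ is the lexicographic product of the reversed orders on colours and on letters.
  ≺-isDecStrictPartialOrder : IsDecStrictPartialOrder _≡_ (_≺_ {m} {n})
  ≺-isDecStrictPartialOrder = record
    { isStrictPartialOrder = record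
      { isEquivalence = isEquivalence
      ; irrefl        = λ { refl → ×-irreflexive {_<₁_ = _>_} {_<₂_ = _>_} >-irrefl >-irrefl (refl , refl) }
      ; trans         = ×-transitive {_<₁_ = _>_} {_<₂_ = _>_} isEquivalence (resp₂ _) >-trans >-trans
      ; <-resp-≈      = resp₂ _
      }
    ; _≟_  = ≡-dec Fin._≟_ Fin._≟_
    ; _<?_ = ×-decidable Fin._≟_ (flip Fin._<?_) (flip Fin._<?_)
    }

  open Peaks ≺-isDecStrictPartialOrder public
  open IsDecStrictPartialOrder ≺-isDecStrictPartialOrder public
    using () renaming (irrefl to ≺-irrefl; _<?_ to _≺?_; _≟_ to _≟ᶜ_)

  InPin⇒Peak : ∀ {f : Fin n → CL m n} {c} → InPin f c → Peak (tabulate f) c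
  InPin⇒Peak {f} (j , l , r , j≡1+l , r≡1+j , fl≺fj , fr≺fj , refl) =
    Peak-tabulate⁺ f j≡1+l r≡1+j fl≺fj fr≺fj

  Peak⇒InPin : ∀ {f : Fin n → CL m n} {c} → Peak (tabulate f) c → InPin f c
  Peak⇒InPin {f} = Peak-tabulate⁻ f

  topColoured : .{{_ : NonZero m}} → Fin n → CL m n
  topColoured x = topColour m , x

  topColoured-⊑ : .{{_ : NonZero m}} (c : CL m n) → topColoured (proj₂ c) ⊑ c
  topColoured-⊑ (a , x) with a Fin.≟ topColour m
  ... | yes refl = inj₂ refl
  ... | no a≢top = inj₁ (inj₁ (Fin.≤∧≢⇒< (≤-topColour a) a≢top))
    where
    ≤-topColour : ∀ {k} .{{_ : NonZero k}} (a : Fin k) → a ≤ᶠ topColour k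
    ≤-topColour {suc k} a = subst (toℕ a ≤_) (sym (Fin.toℕ-fromℕ< _)) (toℕ≤pred[n] a)

-- The canonical witness

module CanonicalWitness {m n : ℕ} .{{_ : NonZero m}} .{{_ : NonZero n}} (P : List (CL m n)) where

  open import Data.List.Membership.DecPropositional (Fin._≟_ {n}) using (_∈?_)

  letters : List (CL m n) → List (Fin n)
  letters = map proj₂

  V : List (Fin n)
  V = complementLetters n P

  V′ : List (CL m n)
  V′ = map topColoured V

  W : List (CL m n)
  W = canonicalWord m n P

  ω : Fin n → CL m n
  ω = canonicalWitness m n P

  ∈-V⁻ : ∀ {x} → x ∈ V → x ∉ letters P
  ∈-V⁻ x∈V = proj₂ (∈-filter⁻ _ {xs = reverse (allFin n)} x∈V)

  ∈-V⁺ : ∀ {x} → x ∉ letters P → x ∈ V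
  ∈-V⁺ {x} x∉P = ∈-filter⁺ _ (Any.reverse⁺ (∈-allFin x)) x∉P

  V-descending : AllPairs (flip _<ᶠ_) V
  V-descending = AllPairs.filter⁺ _ (AllPairs-reverse⁺ (AllPairs.tabulate⁺-< id))

  V′-ascending : AllPairs _≺_ V′
  V′-ascending = AllPairs.map⁺ (AllPairs.map (λ y<x → inj₂ (refl , y<x)) V-descending)

  letters-W-↭ : letters W ↭ V ++ letters P
  letters-W-↭ = begin
    letters (interleave V′ P)  ↭⟨ ↭-map⁺ proj₂ (interleave-↭ V′ P) ⟩
    letters (V′ ++ P)          ≡⟨ map-++ proj₂ V′ P ⟩
    letters V′ ++ letters P    ≡⟨ cong (_++ letters P) (trans (sym (map-∘ V)) (map-id V)) ⟩
    V ++ letters P             ∎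
    where open PermutationReasoning

  module _ (letters-P! : Unique (letters P)) where

    letters-W! : Unique (letters W)
    letters-W! = Unique-resp-↭ (↭-sym letters-W-↭)
      (Unique.++⁺ (AllPairs.map (λ y<x → Fin.<⇒≢ y<x ∘ sym) V-descending) letters-P!
                  λ (x∈V , x∈P) → ∈-V⁻ x∈V x∈P)

    length-W : length W ≡ n
    length-W = trans (sym (length-map proj₂ W)) (length-Unique-covering letters-W! ∈-letters-W)
      where
      ∈-letters-W : ∀ x → x ∈ letters W
      ∈-letters-W x = ∈-resp-↭ (↭-sym letters-W-↭) (case x ∈? letters P of λ
        { (yes x∈P) → Any.++⁺ʳ V x∈P
        ; (no x∉P)  → Any.++⁺ˡ (∈-V⁺ x∉P)
        })

    tabulate-ω : tabulate ω ≡ reverse W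
    tabulate-ω = tabulate-nthOr-reverse topColoured W length-W

    ω-isColPerm : IsColPerm ω
    ω-isColPerm =
      Unique-tabulate⁻ (subst Unique letters-ω≡ (Unique-resp-↭ (↭-sym (↭-reverse _)) letters-W!))
      where
      letters-ω≡ : reverse (letters W) ≡ tabulate (proj₂ ∘ ω)
      letters-ω≡ = begin
        reverse (letters W)     ≡⟨ reverse-map proj₂ W ⟨
        letters (reverse W)     ≡⟨ cong letters tabulate-ω ⟨
        letters (tabulate ω)    ≡⟨ map-tabulate ω proj₂ ⟩
        tabulate (proj₂ ∘ ω)    ∎
        where open ≡-Reasoning

    module _ (zigzag-V′-P : Zigzag V′ P) where

      ∈P⇒InPin-ω : ∀ {c} → c ∈ P → InPin ω c
      ∈P⇒InPin-ω {c} =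
        Peak⇒InPin ∘ subst (λ ws → Peak ws c) (sym tabulate-ω) ∘ Peak-reverse⁺ ∘ Peak-interleave⁺ zigzag-V′-P

      InPin-ω⇒∈P : ∀ {c} → InPin ω c → c ∈ P
      InPin-ω⇒∈P {c} =
        Peak-interleave⁻ zigzag-V′-P ∘ Peak-reverse⁻ ∘ subst (λ ws → Peak ws c) tabulate-ω ∘ InPin⇒Peak

  module Witness (P↑ : AllPairs _≺_ P) (g : Fin n → CL m n) (g-inj : IsColPerm g)
                 (pin : ∀ {c} → c ∈ P → InPin g c) where

    private
      ws : List (CL m n)
      ws = tabulate g

      ⌊_⌋ : CL m n → CL m n
      ⌊ e ⌋ = topColoured (proj₂ e)

      letters-ws! : AllPairs (_≢_ on proj₂) ws
      letters-ws! = AllPairs.tabulate⁺ (λ i≢j → i≢j ∘ g-inj)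

      P! : Unique P
      P! = AllPairs.map (λ a≺b a≡b → ≺-irrefl a≡b a≺b) P↑

      P⊆peaks : P ⊆ peaks ws
      P⊆peaks = Peak⇒∈peaks ∘ InPin⇒Peak ∘ pin

      nonPeak-letter≢ : ∀ {e c} → e ∈ nonPeaks ws → c ∈ P → proj₂ e ≢ proj₂ c
      nonPeak-letter≢ e∈ c∈P = AllPairs-nonPeaks-peaks (_∘ sym) ws letters-ws! e∈ (P⊆peaks c∈P)

      nonPeak-below : ∀ {e c} → c ∈ P → e ∈ nonPeaks ws → e ⊑ c → ⌊ e ⌋ ∈ filter (_≺? c) V′
      nonPeak-below {e} {c} c∈P e∈ e⊑c = ∈-filter⁺ _ (∈-map⁺ topColoured (∈-V⁺ e∉P)) (below e⊑c)
        where
        e∉P : proj₂ e ∉ letters P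
        e∉P e∈P with ∈-map⁻ proj₂ e∈P
        ... | c′ , c′∈P , e≡c′ = nonPeak-letter≢ e∈ c′∈P e≡c′
        below : e ⊑ c → ⌊ e ⌋ ≺ c
        below (inj₁ e≺c) = ⊑-⊏-trans (topColoured-⊑ e) e≺c
        below (inj₂ refl) = contradiction refl (nonPeak-letter≢ e∈ c∈P)

    letters-P! : Unique (letters P)
    letters-P! = Unique-map⁺-local same-letter⇒≡ P!
      where
      same-letter⇒≡ : ∀ {a b} → a ∈ P → b ∈ P → proj₂ a ≡ proj₂ b → a ≡ b
      same-letter⇒≡ a∈P b∈P eq with pin a∈P | pin b∈P
      ... | (j , _ , _ , _ , _ , _ , _ , refl) | (k , _ , _ , _ , _ , _ , _ , refl) = cong g (g-inj eq)

    enoughBelow : EnoughBelow V′ P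
    enoughBelow {c} c∈P = begin
      suc (count (_⊑? c) P)                            ≤⟨ s≤s (Unique-length-≤ _≟ᶜ_ P⊑c! P⊑c⊆peaks⊑c) ⟩
      suc (count (_⊑? c) (peaks ws))                   ≤⟨ count-peaks<nonPeaks (_⊑? c) ⊑c-down ws c⊑c-peak ⟩
      count (_⊑? c) (nonPeaks ws)                      ≡⟨ length-map ⌊_⌋ (filter (_⊑? c) (nonPeaks ws)) ⟨
      length (map ⌊_⌋ (filter (_⊑? c) (nonPeaks ws)))  ≤⟨ Unique-length-≤ _≟ᶜ_ lowered! lowered⊆ ⟩
      count (_≺? c) V′                                 ∎
      where
      open ≤-Reasoning
      P⊑c! : Unique (filter (_⊑? c) P)
      P⊑c! = Unique.filter⁺ (_⊑? c) P!
      P⊑c⊆peaks⊑c : filter (_⊑? c) P ⊆ filter (_⊑? c) (peaks ws)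
      P⊑c⊆peaks⊑c x∈ = let x∈P , x⊑c = ∈-filter⁻ (_⊑? c) x∈ in ∈-filter⁺ (_⊑? c) (P⊆peaks x∈P) x⊑c
      ⊑c-down : ∀ {x y} → x ≺ y → y ⊑ c → x ⊑ c
      ⊑c-down x≺y = inj₁ ∘ ⊏-⊑-trans x≺y
      c⊑c-peak : Any (_⊑ c) (peaks ws)
      c⊑c-peak = Any.map (λ c≡x → inj₂ (sym c≡x)) (P⊆peaks c∈P)
      lowered! : Unique (map ⌊_⌋ (filter (_⊑? c) (nonPeaks ws)))
      lowered! = AllPairs.map⁺ (AllPairs.map (λ e≢f eq → e≢f (cong proj₂ eq))
                   (AllPairs.filter⁺ (_⊑? c) (AllPairs-nonPeaks⁺ ws letters-ws!)))
      lowered⊆ : map ⌊_⌋ (filter (_⊑? c) (nonPeaks ws)) ⊆ filter (_≺? c) V′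
      lowered⊆ y∈ with ∈-map⁻ ⌊_⌋ y∈
      ... | e , e∈ , refl =
        let e∈nonPeaks , e⊑c = ∈-filter⁻ (_⊑? c) {xs = nonPeaks ws} e∈ in nonPeak-below c∈P e∈nonPeaks e⊑c

mainTheorem8 : (m n d : ℕ) → .{{_ : NonZero m}} → .{{_ : NonZero n}} →
    (P : List (CL m n)) → AllPairs _≺_ P → length P ≤ d → Admissible P →
    IsColPerm (canonicalWitness m n P)
    × (∀ c → (c ∈ P → InPin (canonicalWitness m n P) c)
             × (InPin (canonicalWitness m n P) c → c ∈ P))
mainTheorem8 m n d P P↑ _ ((g , g-inj) , Pin[g]≡P) =
  ω-isColPerm letters-P! , λ c → ∈P⇒InPin-ω letters-P! zigzag , InPin-ω⇒∈P letters-P! zigzag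
  where
  open CanonicalWitness P
  open Witness P↑ g g-inj (λ {c} → proj₁ (Pin[g]≡P c))
  zigzag : Zigzag V′ P
  zigzag = EnoughBelow⇒Zigzag V′-ascending P↑ enoughBelow
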